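{- If a rooted graph $(H,K_H)$ is a rooted minor of a rooted graph $(G,K_G)$, then $\mathsf{tw}_K(H,K_H)\le\mathsf{tw}_K(G,K_G)$.
   Context: A rooted graph is $(G,K)$ with $K\subseteq V(G)$. $(H,K_H)$ is a rooted minor of $(G,K_G)$ if obtainable by vertex deletions, edge deletions, contractions of edges (the new vertex is a root iff one of the ends was a root), and removing vertices from the root set. A tree $K$-free-decomposition of $G$ is a triple $(T,\beta,L)$ with $(T,\beta)$ a tree decomposition of $G$, $L\subseteq V(G)\setminus K$, such that every $v\in L$ lies in $\beta(t)$ for a unique $t\in V(T)$ and this $t$ is a leaf of $T$. Its width is $\max\{0,\max_{t\in V(T)}|\beta(t)\setminus L|-1\}$, and the $K$-free treewidth $\mathsf{tw}_K(G,K)$ is the minimum width of a tree $K$-free-decomposition of $G$. -}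

module Defs where

open import Data.Nat using (ℕ; zero; suc; _<_; _≤_; _∸_; _⊔_)
open import Data.Fin using (Fin; punchIn; _≟_)
open import Data.Fin.Subset using (Subset; _∈_; _∉_; _─_; _-_; ∣_∣)
open import Data.List using (List; []; _∷_; _++_; [_]; length; map; foldr; allFin)
open import Data.List.Relation.Unary.Linked using (Linked)
open import Data.List.Relation.Unary.Unique.Propositional using (Unique)
open import Data.Product using (Σ; ∃; ∃-syntax; _×_; _,_)
open import Data.Sum using (_⊎_; inj₁; inj₂)
open import Data.Unit using (⊤)
open import Relation.Nullary using (¬_)
open import Relation.Binary.PropositionalEquality using (_≡_; _≢_; refl) renaming (sym to ≡-sym)
open import Relation.Binary.Construct.Closure.ReflexiveTransitive using (Star)
open import Function.Bundles using (Inverse; _⇔_; _↔_)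
open import Data.Vec using (lookup; tabulate)
open import Data.Bool using (_∨_; _∧_)
open import Relation.Nullary.Decidable using (⌊_⌋)

record Graph (n : ℕ) : Set₁ where
  field
    E      : Fin n → Fin n → Set
    sym    : ∀ {u v} → E u v → E v u
    irrefl : ∀ {u} → ¬ E u u

data WalkIn {n : ℕ} (E : Fin n → Fin n → Set) (P : Fin n → Set)
       : Fin n → Fin n → Set where
  here  : ∀ {a} → P a → WalkIn E P a a
  step  : ∀ {a b c} → P a → E a b → WalkIn E P b c → WalkIn E P a c

ConnectedSet : {n : ℕ} → (Fin n → Fin n → Set) → (Fin n → Set) → Set
ConnectedSet E P = ∀ a b → P a → P b → WalkIn E P a b

HasCycle : {n : ℕ} → (Fin n → Fin n → Set) → Set
HasCycle {n} E =
  Σ (Fin n) λ x → Σ (List (Fin n)) λ xs →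
    (2 ≤ length xs) × Unique (x ∷ xs) × Linked E ((x ∷ xs) ++ [ x ])

record Tree : Set₁ where
  field
    size      : ℕ
    graph     : Graph size
    nonempty  : 0 < size
  open Graph graph public
  field
    connected : ConnectedSet E (λ _ → ⊤)
    acyclic   : ¬ HasCycle E

IsLeaf : (T : Tree) → Fin (Tree.size T) → Set
IsLeaf T t = ∀ a b → Tree.E T t a → Tree.E T t b → a ≡ b

record RGraph : Set₁ where
  field
    n     : ℕ
    graph : Graph n
    K     : Subset n
  open Graph graph public

open RGraph

delVertex : {m : ℕ} (G : Graph (suc m)) (K : Subset (suc m)) (v : Fin (suc m)) → RGraph
delVertex {m} G K v = record
  { n = m
  ; graph = record
      { E = λ i j → Graph.E G (punchIn v i) (punchIn v j)
      ; sym = Graph.sym G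
      ; irrefl = Graph.irrefl G }
  ; K = tabulate (λ i → lookup K (punchIn v i)) }

delEdge : {m : ℕ} (G : Graph m) (K : Subset m) (u v : Fin m) → RGraph
delEdge {m} G K u v = record
  { n = m
  ; graph = record
      { E = E'
      ; sym = λ { (e , p , q) → Graph.sym G e , (λ { (a , b) → q (b , a) }) , (λ { (a , b) → p (b , a) }) }
      ; irrefl = λ { (e , _) → Graph.irrefl G e } }
  ; K = K }
  where
    E' : Fin m → Fin m → Set
    E' a b = Graph.E G a b × ¬ (a ≡ u × b ≡ v) × ¬ (a ≡ v × b ≡ u)

-- contraction of the edge uv: v is merged into u (the merged vertex sits
-- at u's position; remaining vertices are relabelled by punchIn v); the
-- merged vertex is a root iff u or v was a root
contract : {m : ℕ} (G : Graph (suc m)) (K : Subset (suc m)) (u v : Fin (suc m)) → RGraph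
contract {m} G K u v = record
  { n = m
  ; graph = record
      { E = E'
      ; sym = λ { (ne , inj₁ e) → (λ eq → ne (≡-sym eq)) , inj₁ (Graph.sym G e)
                ; (ne , inj₂ (inj₁ (p , e))) → (λ eq → ne (≡-sym eq)) , inj₂ (inj₂ (p , Graph.sym G e))
                ; (ne , inj₂ (inj₂ (p , e))) → (λ eq → ne (≡-sym eq)) , inj₂ (inj₁ (p , Graph.sym G e)) }
      ; irrefl = λ { (ne , _) → ne refl } }
  ; K = tabulate (λ i → lookup K (punchIn v i) ∨ (⌊ punchIn v i ≟ u ⌋ ∧ lookup K v)) }
  where
    pi : Fin m → Fin (suc m)
    pi = punchIn v
    E' : Fin m → Fin m → Set
    E' i j = i ≢ j × (Graph.E G (pi i) (pi j)
                      ⊎ (pi i ≡ u × Graph.E G v (pi j))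
                      ⊎ (pi j ≡ u × Graph.E G (pi i) v))

data Step : RGraph → RGraph → Set₁ where
  vertexDeletion : ∀ {m} (G : Graph (suc m)) (K : Subset (suc m)) (v : Fin (suc m)) →
                   Step (record { n = suc m ; graph = G ; K = K }) (delVertex G K v)
  edgeDeletion   : ∀ {m} (G : Graph m) (K : Subset m) (u v : Fin m) → Graph.E G u v →
                   Step (record { n = m ; graph = G ; K = K }) (delEdge G K u v)
  contraction    : ∀ {m} (G : Graph (suc m)) (K : Subset (suc m)) (u v : Fin (suc m)) → Graph.E G u v →
                   Step (record { n = suc m ; graph = G ; K = K }) (contract G K u v)
  rootRemoval    : ∀ {m} (G : Graph m) (K : Subset m) (r : Fin m) →
                   Step (record { n = m ; graph = G ; K = K }) (record { n = m ; graph = G ; K = K - r })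

record Iso (H G : RGraph) : Set where
  field
    σ      : Fin (n H) ↔ Fin (n G)
  open Inverse σ using (to)
  field
    edges  : ∀ a b → E H a b ⇔ E G (to a) (to b)
    roots  : ∀ a → (a ∈ K H) ⇔ (to a ∈ K G)

RootedMinor : RGraph → RGraph → Set₁
RootedMinor H G = Σ RGraph λ G' → Star Step G G' × Iso H G'

record TreeDecomposition {n : ℕ} (G : Graph n) : Set₁ where
  field
    T      : Tree
    β      : Fin (Tree.size T) → Subset n
    vertexCover : ∀ v → ∃[ t ] v ∈ β t
    edgeCover   : ∀ u v → Graph.E G u v → ∃[ t ] (u ∈ β t × v ∈ β t)
    coherent    : ∀ v → ConnectedSet (Tree.E T) (λ t → v ∈ β t)

record KFreeDecomposition (G : RGraph) : Set₁ where
  field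
    td : TreeDecomposition (graph G)
  open TreeDecomposition td public
  field
    L       : Subset (n G)
    L∩K=∅   : ∀ v → v ∈ L → v ∉ K G
    leafBag : ∀ v → v ∈ L →
              Σ (Fin (Tree.size T)) λ t → v ∈ β t × (∀ t' → v ∈ β t' → t' ≡ t) × IsLeaf T t

width : {G : RGraph} → KFreeDecomposition G → ℕ
width D = foldr _⊔_ 0 (map (λ t → ∣ β t ─ L ∣ ∸ 1) (allFin (Tree.size T)))
  where open KFreeDecomposition D

{-# OPTIONS --safe #-}
module Submission where

-- A rooted minor H of G is witnessed by a model: pairwise disjoint connected
-- branch sets in G, one for each vertex of H, realising the edges and roots of H.
-- A K-free decomposition (T, β, L) of G is pulled back along a model over the same
-- tree: x joins β′(t) when its branch set meets β(t), and joins L′ when its branch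
-- set lies inside L.  A vertex of L has all its neighbours in its unique leaf bag,
-- so a connected branch set inside L lies in a single leaf bag, and any bag meeting
-- a branch set not inside L contains a vertex of that branch set outside L.  As the
-- branch sets are disjoint, |β′(t) ∖ L′| ≤ |β(t) ∖ L| for every t.

open import Defs
open import Data.Nat using (ℕ; suc; _≤_; _⊔_; z≤n)
open import Data.Nat.Properties using (≤-refl; ≤-trans; ≤-<-trans; ⊔-mono-≤; ∸-monoˡ-≤)
open import Data.Product using (∃; ∃₂; _×_; _,_; Σ)
open import Data.Sum using (_⊎_; inj₁; inj₂)
open import Data.Empty using (⊥-elim)
open import Data.Bool using (Bool; true; false; _∨_; _∧_)
open import Data.Fin using (Fin; zero; suc; punchIn; _≟_)
open import Data.Fin.Properties using (0≢1+n; suc-injective; any?; punchIn-injective; punchInᵢ≢i)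
open import Data.Fin.Subset using (Subset; inside; outside; _∈_; _∉_; _─_; _-_; ∣_∣; ⁅_⁆)
open import Data.Fin.Subset.Properties
  using (_∈?_; p─q⊆p; x∈p∧x∉q⇒x∈p─q; x∈p∧x≢y⇒x∈p-y; x∈p⇒∣p-x∣<∣p∣)
open import Data.List using (List; []; _∷_; map; foldr; allFin)
open import Data.Vec using ([]; _∷_; lookup; tabulate; here; there)
open import Data.Vec.Properties using ([]=⇒lookup; lookup⇒[]=; lookup∘tabulate)
open import Function using (id; _∘_)
open import Function.Bundles using (Inverse; Equivalence; Injection)
open import Function.Definitions using (Injective)
open import Function.Properties.Inverse using (Inverse⇒Injection)
open import Relation.Nullary using (¬_; Dec; yes; no; does)
open import Relation.Nullary.Decidable using (_×-dec_; _⊎-dec_; ¬?; dec-true; decidable-stable; ⌊_⌋)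
open import Relation.Binary.PropositionalEquality using (_≡_; refl; sym; trans; subst)
open import Relation.Binary.Construct.Closure.ReflexiveTransitive using (Star; ε; _◅_)

private
  variable
    k l : ℕ

∈-tabulate⁺ : {f : Fin k → Bool} {x : Fin k} → f x ≡ true → x ∈ tabulate f
∈-tabulate⁺ {f = f} {x} fx = lookup⇒[]= x (tabulate f) (trans (lookup∘tabulate f x) fx)

∈-tabulate⁻ : {f : Fin k → Bool} {x : Fin k} → x ∈ tabulate f → f x ≡ true
∈-tabulate⁻ {f = f} {x} x∈ = trans (sym (lookup∘tabulate f x)) ([]=⇒lookup x∈)

filter : {P : Fin k → Set} → (∀ x → Dec (P x)) → Subset k
filter P? = tabulate (does ∘ P?)

∈-filter⁺ : {P : Fin k → Set} (P? : ∀ x → Dec (P x)) {x : Fin k} → P x → x ∈ filter P?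
∈-filter⁺ P? {x} px = ∈-tabulate⁺ (dec-true (P? x) px)

∈-filter⁻ : {P : Fin k → Set} (P? : ∀ x → Dec (P x)) {x : Fin k} → x ∈ filter P? → P x
∈-filter⁻ P? {x} x∈ with P? x | ∈-tabulate⁻ x∈
... | yes px | _  = px
... | no  _  | ()

x∈p─q⇒x∉q : {p q : Subset k} {x : Fin k} → x ∈ p ─ q → x ∉ q
x∈p─q⇒x∉q {p = s ∷ p} {inside ∷ q}  {zero}  ()         _
x∈p─q⇒x∉q {p = s ∷ p} {outside ∷ q} {zero}  _          ()
x∈p─q⇒x∉q {p = s ∷ p} {t ∷ q}       {suc x} (there x∈) (there x∈q) = x∈p─q⇒x∉q x∈ x∈q

injectiveRel⇒∣p∣≤∣q∣ : (R : Fin k → Fin l → Set) → (∀ {x x′ y} → R x y → R x′ y → x ≡ x′) →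
                       (p : Subset k) (q : Subset l) →
                       (∀ {x} → x ∈ p → ∃ λ y → y ∈ q × R x y) → ∣ p ∣ ≤ ∣ q ∣
injectiveRel⇒∣p∣≤∣q∣ R inj []            q cover = z≤n
injectiveRel⇒∣p∣≤∣q∣ R inj (outside ∷ p) q cover =
  injectiveRel⇒∣p∣≤∣q∣ (R ∘ suc) (λ r r′ → suc-injective (inj r r′)) p q (cover ∘ there)
injectiveRel⇒∣p∣≤∣q∣ R inj (inside ∷ p)  q cover with cover here
... | y₀ , y₀∈q , r₀ =
  ≤-<-trans (injectiveRel⇒∣p∣≤∣q∣ (R ∘ suc) (λ r r′ → suc-injective (inj r r′)) p (q - y₀) cover′)
            (x∈p⇒∣p-x∣<∣p∣ y₀∈q)
  where
    cover′ : ∀ {x} → x ∈ p → ∃ λ y → y ∈ q - y₀ × R (suc x) y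
    cover′ x∈p with cover (there x∈p)
    ... | y , y∈q , r = y , x∈p∧x≢y⇒x∈p-y y∈q (λ { refl → 0≢1+n (inj r₀ r) }) , r

foldr-⊔-mono : {A : Set} {f g : A → ℕ} → (∀ a → f a ≤ g a) →
               (xs : List A) → foldr _⊔_ 0 (map f xs) ≤ foldr _⊔_ 0 (map g xs)
foldr-⊔-mono f≤g []       = z≤n
foldr-⊔-mono f≤g (x ∷ xs) = ⊔-mono-≤ (f≤g x) (foldr-⊔-mono f≤g xs)

module _ {E : Fin k → Fin k → Set} where

  mapʷ : {P Q : Fin k → Set} → (∀ {a} → P a → Q a) →
         ∀ {a b} → WalkIn E P a b → WalkIn E Q a b
  mapʷ f (here pa)     = here (f pa)
  mapʷ f (step pa e w) = step (f pa) e (mapʷ f w)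

  _++ʷ_ : {P : Fin k → Set} {a b c : Fin k} → WalkIn E P a b → WalkIn E P b c → WalkIn E P a c
  here _     ++ʷ w′ = w′
  step pa e w ++ʷ w′ = step pa e (w ++ʷ w′)

module _ {G : Graph k} (td : TreeDecomposition G) where
  open TreeDecomposition td

  Meets : (Fin k → Set) → Fin (Tree.size T) → Set
  Meets P t = ∃ λ y → P y × y ∈ β t

  walk⇒treeWalk : {P : Fin k → Set} {a b : Fin k} {t₁ t₂ : Fin (Tree.size T)} →
                  WalkIn (Graph.E G) P a b → a ∈ β t₁ → b ∈ β t₂ →
                  WalkIn (Tree.E T) (Meets P) t₁ t₂
  walk⇒treeWalk (here pa) a∈ b∈ = mapʷ (λ a∈t → _ , pa , a∈t) (coherent _ _ _ a∈ b∈)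
  walk⇒treeWalk (step {a} {b} pa e w) a∈ c∈ with edgeCover a b e
  ... | s , a∈s , b∈s =
    mapʷ (λ a∈t → a , pa , a∈t) (coherent a _ s a∈ a∈s) ++ʷ walk⇒treeWalk w b∈s c∈

module _ {G : RGraph} (D : KFreeDecomposition G) where
  open KFreeDecomposition D

  leafNeighbour∈bag : ∀ {a b t} → a ∈ L → RGraph.E G a b → a ∈ β t → b ∈ β t
  leafNeighbour∈bag {a} {b} {t} a∈L e a∈t with leafBag a a∈L | edgeCover a b e
  ... | s , _ , unique , _ | s′ , a∈s′ , b∈s′ =
    subst (λ r → b ∈ β r) (trans (unique s′ a∈s′) (sym (unique t a∈t))) b∈s′

  walkLeavesL⊎endsInBag : ∀ {P a b t} → WalkIn (RGraph.E G) P a b → a ∈ β t →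
                          (∃ λ y → P y × y ∈ β t × y ∉ L) ⊎ b ∈ β t
  walkLeavesL⊎endsInBag         (here _)      a∈t = inj₂ a∈t
  walkLeavesL⊎endsInBag {a = a} (step pa e w) a∈t with a ∈? L
  ... | no  a∉L = inj₁ (a , pa , a∈t , a∉L)
  ... | yes a∈L = walkLeavesL⊎endsInBag w (leafNeighbour∈bag a∈L e a∈t)

record Model (H G : RGraph) : Set₁ where
  field
    branch    : Fin (RGraph.n H) → Fin (RGraph.n G) → Set
    branch?   : ∀ x y → Dec (branch x y)
    disjoint  : ∀ {x x′ y} → branch x y → branch x′ y → x ≡ x′
    inhabited : ∀ x → ∃ (branch x)
    connected : ∀ x → ConnectedSet (RGraph.E G) (branch x)
    edge      : ∀ {x x′} → RGraph.E H x x′ →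
                ∃₂ λ y y′ → branch x y × branch x′ y′ × RGraph.E G y y′
    root      : ∀ {x} → x ∈ RGraph.K H → ∃ λ y → branch x y × y ∈ RGraph.K G

_≼tw_ : RGraph → RGraph → Set₁
H ≼tw G = (D : KFreeDecomposition G) → Σ (KFreeDecomposition H) λ D′ → width D′ ≤ width D

≼tw-refl : {G : RGraph} → G ≼tw G
≼tw-refl D = D , ≤-refl

≼tw-trans : {F G H : RGraph} → F ≼tw G → G ≼tw H → F ≼tw H
≼tw-trans F≼G G≼H D with G≼H D
... | D₁ , le₁ with F≼G D₁
... | D₂ , le₂ = D₂ , ≤-trans le₂ le₁

module Pullback {H G : RGraph} (μ : Model H G) (D : KFreeDecomposition G) where
  open Model μ
  open KFreeDecomposition D

  LeavesL : Fin (RGraph.n H) → Set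
  LeavesL x = ∃ λ y → branch x y × y ∉ L

  leavesL? : ∀ x → Dec (LeavesL x)
  leavesL? x = any? λ y → branch? x y ×-dec ¬? (y ∈? L)

  meets? : ∀ t x → Dec (Meets td (branch x) t)
  meets? t x = any? λ y → branch? x y ×-dec y ∈? β t

  β′ : Fin (Tree.size T) → Subset (RGraph.n H)
  β′ t = filter (meets? t)

  L′ : Subset (RGraph.n H)
  L′ = filter (¬? ∘ leavesL?)

  ∈β′⁺ : ∀ {x y t} → branch x y → y ∈ β t → x ∈ β′ t
  ∈β′⁺ {t = t} m y∈t = ∈-filter⁺ (meets? t) (_ , m , y∈t)

  ∈β′⁻ : ∀ {x t} → x ∈ β′ t → Meets td (branch x) t
  ∈β′⁻ {t = t} = ∈-filter⁻ (meets? t)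

  td′ : TreeDecomposition (RGraph.graph H)
  td′ = record
    { T = T ; β = β′ ; vertexCover = vertexCover′ ; edgeCover = edgeCover′ ; coherent = coherent′ }
    where
      vertexCover′ : ∀ x → ∃ λ t → x ∈ β′ t
      vertexCover′ x with inhabited x
      ... | y , m with vertexCover y
      ... | t , y∈t = t , ∈β′⁺ m y∈t

      edgeCover′ : ∀ x x′ → RGraph.E H x x′ → ∃ λ t → x ∈ β′ t × x′ ∈ β′ t
      edgeCover′ x x′ e with edge e
      ... | y , y′ , m , m′ , e′ with edgeCover y y′ e′
      ... | t , y∈t , y′∈t = t , ∈β′⁺ m y∈t , ∈β′⁺ m′ y′∈t

      coherent′ : ∀ x → ConnectedSet (Tree.E T) (λ t → x ∈ β′ t)
      coherent′ x t₁ t₂ x∈₁ x∈₂ with ∈β′⁻ x∈₁ | ∈β′⁻ x∈₂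
      ... | y₁ , m₁ , y₁∈ | y₂ , m₂ , y₂∈ =
        mapʷ (λ {t} → ∈-filter⁺ (meets? t)) (walk⇒treeWalk td (connected x y₁ y₂ m₁ m₂) y₁∈ y₂∈)

  branchInL∈bag : ∀ {x y y′ t} → ¬ LeavesL x → branch x y → branch x y′ → y ∈ β t → y′ ∈ β t
  branchInL∈bag {x} {y} {y′} inL m m′ y∈t with walkLeavesL⊎endsInBag D (connected x y y′ m m′) y∈t
  ... | inj₁ (z , mz , _ , z∉L) = ⊥-elim (inL (z , mz , z∉L))
  ... | inj₂ y′∈t               = y′∈t

  leafBag′ : ∀ x → x ∈ L′ → Σ (Fin (Tree.size T)) λ t →
             x ∈ β′ t × (∀ t′ → x ∈ β′ t′ → t′ ≡ t) × IsLeaf T t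
  leafBag′ x x∈L′ with ∈-filter⁻ (¬? ∘ leavesL?) x∈L′ | inhabited x
  ... | inL | y₀ , m₀ with leafBag y₀ (decidable-stable (y₀ ∈? L) (λ y₀∉L → inL (y₀ , m₀ , y₀∉L)))
  ... | t , y₀∈t , unique , leaf = t , ∈β′⁺ m₀ y₀∈t , unique′ , leaf
    where
      unique′ : ∀ t′ → x ∈ β′ t′ → t′ ≡ t
      unique′ t′ x∈t′ with ∈β′⁻ x∈t′
      ... | y , m , y∈t′ = unique t′ (branchInL∈bag inL m m₀ y∈t′)

  L′∩K=∅ : ∀ x → x ∈ L′ → x ∉ RGraph.K H
  L′∩K=∅ x x∈L′ x∈K with root x∈K
  ... | y , m , y∈K = ∈-filter⁻ (¬? ∘ leavesL?) x∈L′ (y , m , λ y∈L → L∩K=∅ y y∈L y∈K)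

  D′ : KFreeDecomposition H
  D′ = record { td = td′ ; L = L′ ; L∩K=∅ = L′∩K=∅ ; leafBag = leafBag′ }

  nonLeafWitness : ∀ t {x} → x ∈ β′ t ─ L′ → ∃ λ y → y ∈ β t ─ L × branch x y
  nonLeafWitness t {x} x∈ with ∈β′⁻ (p─q⊆p (β′ t) L′ x∈)
                             | decidable-stable (leavesL? x) (x∈p─q⇒x∉q x∈ ∘ ∈-filter⁺ (¬? ∘ leavesL?))
  ... | y , m , y∈t | z , mz , z∉L with walkLeavesL⊎endsInBag D (connected x y z m mz) y∈t
  ... | inj₁ (w , mw , w∈t , w∉L) = w , x∈p∧x∉q⇒x∈p─q w∈t w∉L , mw
  ... | inj₂ z∈t                  = z , x∈p∧x∉q⇒x∈p─q z∈t z∉L , mz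

  ∣β′─L′∣≤∣β─L∣ : ∀ t → ∣ β′ t ─ L′ ∣ ≤ ∣ β t ─ L ∣
  ∣β′─L′∣≤∣β─L∣ t = injectiveRel⇒∣p∣≤∣q∣ branch disjoint (β′ t ─ L′) (β t ─ L) (nonLeafWitness t)

  width-D′≤width-D : width D′ ≤ width D
  width-D′≤width-D = foldr-⊔-mono (λ t → ∸-monoˡ-≤ 1 (∣β′─L′∣≤∣β─L∣ t)) (allFin _)

model⇒≼tw : {H G : RGraph} → Model H G → H ≼tw G
model⇒≼tw μ D = D′ , width-D′≤width-D
  where open Pullback μ D

embeddingModel : {H G : RGraph} (f : Fin (RGraph.n H) → Fin (RGraph.n G)) → Injective _≡_ _≡_ f →
                 (∀ {x x′} → RGraph.E H x x′ → RGraph.E G (f x) (f x′)) →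
                 (∀ {x} → x ∈ RGraph.K H → f x ∈ RGraph.K G) → Model H G
embeddingModel f f-inj f-edge f-root = record
  { branch    = λ x y → y ≡ f x
  ; branch?   = λ x y → y ≟ f x
  ; disjoint  = λ { refl q → f-inj q }
  ; inhabited = λ x → f x , refl
  ; connected = λ { x _ _ refl refl → here refl }
  ; edge      = λ e → _ , _ , refl , refl , f-edge e
  ; root      = λ x∈K → _ , refl , f-root x∈K
  }

module Contraction {m : ℕ} (G : Graph (suc m)) (K : Subset (suc m)) (u v : Fin (suc m))
                   (uv : Graph.E G u v) where

  Merged : Fin m → Fin (suc m) → Set
  Merged x y = y ≡ punchIn v x ⊎ (punchIn v x ≡ u × y ≡ v)

  mergedRoot : ∀ x → (lookup K (punchIn v x) ∨ (⌊ punchIn v x ≟ u ⌋ ∧ lookup K v)) ≡ true →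
               ∃ λ y → Merged x y × y ∈ K
  mergedRoot x x∈K′ with lookup K (punchIn v x) in x∈K
  ... | true = punchIn v x , inj₁ refl , lookup⇒[]= _ K x∈K
  ... | false with punchIn v x ≟ u
  ...   | yes x≡u = v , inj₂ (x≡u , refl) , lookup⇒[]= v K x∈K′
  ...   | no  _   with () ← x∈K′

  model : Model (contract G K u v) (record { n = suc m ; graph = G ; K = K })
  Model.branch    model = Merged
  Model.branch?   model x y = (y ≟ punchIn v x) ⊎-dec ((punchIn v x ≟ u) ×-dec (y ≟ v))
  Model.disjoint  model (inj₁ refl)       (inj₁ q)        = punchIn-injective v _ _ q
  Model.disjoint  model (inj₁ refl)       (inj₂ (_ , q))  = ⊥-elim (punchInᵢ≢i v _ q)
  Model.disjoint  model (inj₂ (_ , refl)) (inj₁ q)        = ⊥-elim (punchInᵢ≢i v _ (sym q))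
  Model.disjoint  model (inj₂ (p , _))    (inj₂ (p′ , _)) = punchIn-injective v _ _ (trans p (sym p′))
  Model.inhabited model x = punchIn v x , inj₁ refl
  Model.connected model x _ _ (inj₁ refl)       (inj₁ refl)       = here (inj₁ refl)
  Model.connected model x _ _ (inj₁ refl)       (inj₂ (p , refl)) =
    step (inj₁ refl) (subst (λ w → Graph.E G w v) (sym p) uv) (here (inj₂ (p , refl)))
  Model.connected model x _ _ (inj₂ (p , refl)) (inj₁ refl)       =
    step (inj₂ (p , refl)) (subst (Graph.E G v) (sym p) (Graph.sym G uv)) (here (inj₁ refl))
  Model.connected model x _ _ (inj₂ (p , refl)) (inj₂ (_ , refl)) = here (inj₂ (p , refl))
  Model.edge      model (_ , inj₁ e)              = _ , _ , inj₁ refl , inj₁ refl , e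
  Model.edge      model (_ , inj₂ (inj₁ (p , e))) = _ , _ , inj₂ (p , refl) , inj₁ refl , e
  Model.edge      model (_ , inj₂ (inj₂ (p , e))) = _ , _ , inj₁ refl , inj₂ (p , refl) , e
  Model.root      model {x} x∈K = mergedRoot x (∈-tabulate⁻ x∈K)

stepModel : {G G′ : RGraph} → Step G G′ → Model G′ G
stepModel (vertexDeletion G K v) =
  embeddingModel (punchIn v) (punchIn-injective v _ _) id (λ x∈K → lookup⇒[]= _ K (∈-tabulate⁻ x∈K))
stepModel (edgeDeletion G K u v _) = embeddingModel id id (λ (e , _) → e) id
stepModel (contraction G K u v uv) = Contraction.model G K u v uv
stepModel (rootRemoval G K r)      = embeddingModel id id id (p─q⊆p K ⁅ r ⁆)

isoModel : {H G : RGraph} → Iso H G → Model H G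
isoModel i = embeddingModel to (Injection.injective (Inverse⇒Injection σ))
               (Equivalence.to (edges _ _)) (Equivalence.to (roots _))
  where open Iso i
        open Inverse σ using (to)

steps⇒≼tw : {G G′ : RGraph} → Star Step G G′ → G′ ≼tw G
steps⇒≼tw ε        = ≼tw-refl
steps⇒≼tw (s ◅ ss) = ≼tw-trans (steps⇒≼tw ss) (model⇒≼tw (stepModel s))

mainTheorem11 : (H G : RGraph) → RootedMinor H G →
    (D : KFreeDecomposition G) → Σ (KFreeDecomposition H) (λ D' → width D' ≤ width D)
mainTheorem11 H G (G′ , ss , iso) = ≼tw-trans (model⇒≼tw (isoModel iso)) (steps⇒≼tw ss)
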